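{- Let $k\ge 2$, let $\Gamma$ be a simple connected graph, and let $\Gamma_1,\Gamma_2$ be $k$-subgraphs of $\Gamma$ having more than $k$ common vertices. Then $\Gamma_1\cup\Gamma_2$ is a $k$-subgraph of $\Gamma$ as well.
   Context: For a finite simple undirected graph $\Gamma=(V,E)$, the flow semigroup $S_\Gamma$ is the semigroup of transformations of $V$ (acting on the right) generated by the elementary collapsings $e_{uv}$ and $e_{vu}$ for all edges $uv\in E$, where $e_{uv}$ maps $u$ to $v$ and fixes every other vertex. For $1\le k\le |V|-1$ and $V_k\subseteq V$ with $|V_k|=k$, the defect $k$ group $G_{k,V_k}$ is the permutation group on $V\setminus V_k$ generated by the restrictions $s|_{V\setminus V_k}$ of all $s\in S_\Gamma$ with $(V\setminus V_k)s=V\setminus V_k$ and $V_k s\subseteq V\setminus V_k$; for connected $\Gamma$ it is independent of $V_k$ up to permutation isomorphism and is called the defect $k$ group of $\Gamma$. A subgraph $(V',E')$ has $V'\subseteq V$, $E'\subseteq E$, with its own flow semigroup. For $k\ge2$, a connected subgraph $\Gamma'$ of $\Gamma$ (with more than $k$ vertices) is a $k$-subgraph if its defect $k$ group is the full symmetric group of degree $|\Gamma'|-k$, where $|\Gamma'|$ is its number of vertices. -}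

module Defs where

open import Data.Nat using (ℕ; _<_; _≤_)
open import Data.Fin using (Fin; _≟_)
open import Data.Fin.Subset using (Subset; _∈_; _∉_; _⊆_; _∪_; _─_; ∣_∣)
open import Data.Product using (Σ; _×_; ∃; ∃-syntax; _,_)
open import Data.Sum using (_⊎_)
open import Function using (_∘_; id)
open import Relation.Nullary using (¬_; yes; no)
open import Relation.Binary.PropositionalEquality using (_≡_)

-- Maps are written as functions Fin n → Fin n, but the paper's right action
-- (x)(s t) = ((x)s)t corresponds to the function composition t ∘ s.

record Graph (n : ℕ) : Set₁ where
  field
    Edge  : Fin n → Fin n → Set
    sym   : ∀ {u v} → Edge u v → Edge v u
    irrefl : ∀ {u} → ¬ Edge u u
open Graph public

record Subgraph {n : ℕ} (Γ : Graph n) : Set₁ where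
  field
    Vs    : Subset n
    Es    : Fin n → Fin n → Set
    Es-sym : ∀ {u v} → Es u v → Es v u
    Es⊆E  : ∀ {u v} → Es u v → Edge Γ u v
    Es-src : ∀ {u v} → Es u v → u ∈ Vs
    Es-tgt : ∀ {u v} → Es u v → v ∈ Vs
open Subgraph public

_∪ᴳ_ : ∀ {n} {Γ : Graph n} → Subgraph Γ → Subgraph Γ → Subgraph Γ
Γ₁ ∪ᴳ Γ₂ = record
  { Vs = Vs Γ₁ ∪ Vs Γ₂
  ; Es = λ u v → Es Γ₁ u v ⊎ Es Γ₂ u v
  ; Es-sym = λ { (_⊎_.inj₁ e) → _⊎_.inj₁ (Es-sym Γ₁ e) ; (_⊎_.inj₂ e) → _⊎_.inj₂ (Es-sym Γ₂ e) }
  ; Es⊆E = λ { (_⊎_.inj₁ e) → Es⊆E Γ₁ e ; (_⊎_.inj₂ e) → Es⊆E Γ₂ e }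
  ; Es-src = λ { (_⊎_.inj₁ e) → x∈p⇒x∈p∪q (Es-src Γ₁ e) ; (_⊎_.inj₂ e) → x∈q⇒x∈p∪q (Es-src Γ₂ e) }
  ; Es-tgt = λ { (_⊎_.inj₁ e) → x∈p⇒x∈p∪q (Es-tgt Γ₁ e) ; (_⊎_.inj₂ e) → x∈q⇒x∈p∪q (Es-tgt Γ₂ e) }
  }
  where
  open import Data.Fin.Subset.Properties using (x∈p∪q⁺)
  x∈p⇒x∈p∪q : ∀ {x p q} → x ∈ p → x ∈ p ∪ q
  x∈p⇒x∈p∪q i = x∈p∪q⁺ (_⊎_.inj₁ i)
  x∈q⇒x∈p∪q : ∀ {x p q} → x ∈ q → x ∈ p ∪ q
  x∈q⇒x∈p∪q i = x∈p∪q⁺ (_⊎_.inj₂ i)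

whole : ∀ {n} (Γ : Graph n) → Subgraph Γ
whole Γ = record
  { Vs = Data.Fin.Subset.⊤
  ; Es = Edge Γ
  ; Es-sym = sym Γ
  ; Es⊆E = λ e → e
  ; Es-src = λ {u} _ → ∈⊤
  ; Es-tgt = λ {_} {v} _ → ∈⊤
  }
  where
  open import Data.Fin.Subset.Properties using (∈⊤)
  import Data.Fin.Subset

data Path {n : ℕ} (E : Fin n → Fin n → Set) : Fin n → Fin n → Set where
  here : ∀ {u} → Path E u u
  step : ∀ {u v w} → E u v → Path E v w → Path E u w

Connected : ∀ {n} {Γ : Graph n} → Subgraph Γ → Set
Connected Γ' = ∀ u v → u ∈ Vs Γ' → v ∈ Vs Γ' → Path (Es Γ') u v

collapse : ∀ {n} → Fin n → Fin n → Fin n → Fin n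
collapse u v x with x ≟ u
... | yes _ = v
... | no  _ = x

-- The flow semigroup of a subgraph: generated by the e_uv for edges uv of E'.
-- (Its elements fix vertices outside V'; their restrictions to V' are the
-- transformations of V' in the paper's sense.)
-- comp s t is the product s t in right-action notation, i.e. the map t ∘ s.
data Flow {n : ℕ} (E : Fin n → Fin n → Set) : (Fin n → Fin n) → Set where
  gen  : ∀ {u v} → E u v → Flow E (collapse u v)
  comp : ∀ {s t} → Flow E s → Flow E t → Flow E (t ∘ s)

Admissible : ∀ {n} → Subset n → Subset n → (Fin n → Fin n) → Set
Admissible W Vk s =
  (∀ x → x ∈ W → s x ∈ W) × (∀ y → y ∈ W → ∃[ x ] (x ∈ W × s x ≡ y))
  × (∀ x → x ∈ Vk → s x ∈ W)

-- The permutation group on W generated by the restrictions s|_W of the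
-- admissible elements s of the flow semigroup of E.  An element of the group
-- is represented by a map f : Fin n → Fin n; only its restriction to W matters.
data DefectGroup {n : ℕ} (E : Fin n → Fin n → Set) (W Vk : Subset n)
     : (Fin n → Fin n) → Set where
  gen  : ∀ {s} → Flow E s → Admissible W Vk s → DefectGroup E W Vk s
  one  : DefectGroup E W Vk id
  comp : ∀ {f g} → DefectGroup E W Vk f → DefectGroup E W Vk g
       → DefectGroup E W Vk (g ∘ f)
  inv  : ∀ {f g} → DefectGroup E W Vk f
       → (∀ x → x ∈ W → g x ∈ W) → (∀ x → x ∈ W → f (g x) ≡ x)
       → DefectGroup E W Vk g

IsPermOn : ∀ {n} → Subset n → (Fin n → Fin n) → Set
IsPermOn W π = (∀ x → x ∈ W → π x ∈ W)
             × (∀ x y → x ∈ W → y ∈ W → π x ≡ π y → x ≡ y)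

DefectFull : ∀ {n} {Γ : Graph n} → Subgraph Γ → Subset n → Set
DefectFull Γ' Vk =
  ∀ π → IsPermOn (Vs Γ' ─ Vk) π →
    ∃[ f ] (DefectGroup (Es Γ') (Vs Γ' ─ Vk) Vk f
            × (∀ x → x ∈ Vs Γ' ─ Vk → f x ≡ π x))

-- Since the defect k group of a connected graph does not depend on V_k,
-- we require this for every V_k ⊆ V' with |V_k| = k.
IsKSubgraph : ∀ {n} {Γ : Graph n} → ℕ → Subgraph Γ → Set
IsKSubgraph k Γ' =
  Connected Γ' × k < ∣ Vs Γ' ∣
  × (∀ Vk → Vk ⊆ Vs Γ' → ∣ Vk ∣ ≡ k → DefectFull Γ' Vk)

-- The defect group at V_k is the full symmetric group on V′ ∖ V_k as soon as it contains every
-- transposition. Put I = V₁ ∩ V₂. If V_k ⊆ I, a transposition of two vertices of Γᵢ comes from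
-- the defect group of Γᵢ, since flow elements of Γᵢ fix every vertex outside Γᵢ; a transposition
-- (x y) with x only in Γ₁ and y only in Γ₂ is the conjugate (x c)(c y)(x c) by a common vertex
-- c ∉ V_k, which exists because |I| > k.
-- An arbitrary k-set V_k can be slid, one vertex at a time along paths, onto a k-set V_k′ ⊆ I.
-- Followed by a flow element that pushes the target set off itself, the slides become flow
-- elements a, b mapping V′ ∖ V_k bijectively onto V′ ∖ V_k′ and back, and V_k, V_k′ into these
-- complements. Conjugation by b, realised in the defect group as (b s a)(b a)⁻¹, then carries
-- the symmetric group at V_k′ to the one at V_k.

module Submission where

open import Data.Bool using (true; false; if_then_else_)
open import Data.Fin as Fin using (Fin; _≟_)
open import Data.Fin.Permutation.Components using (transpose; transpose-inverse)
open import Data.Fin.Subset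
  using (Subset; _∈_; _∉_; _⊆_; _∪_; _∩_; _─_; _-_; ⁅_⁆; ∣_∣; Nonempty)
open import Data.Fin.Subset.Properties
  using (_∈?_; nonempty?; x∈p∧x∉q⇒x∈p─q; p─q⊆p; x∈p∪q⁺; x∈p∪q⁻; x∈p∩q⁻; ∣⊥∣≡0; Empty-unique
        ; p⊆q⇒∣p∣≤∣q∣; x∈p⇒∣p-x∣<∣p∣; p─⊥≡p; ∪-identityʳ; ⊆-antisym; x∈p∧x≢y⇒x∈p-y
        ; x∈⁅x⁆; x∈⁅y⁆⇒x≡y; x≢y⇒x∉⁅y⁆; x∉⁅y⁆⇒x≢y)
open import Data.List using (List; []; _∷_; allFin)
open import Data.List.Membership.Propositional using () renaming (_∉_ to _∉ₗ_)
open import Data.List.Membership.Propositional.Properties using (∈-allFin)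
open import Data.List.Relation.Unary.Any using (here; there)
open import Data.Nat using (ℕ; suc; _≤_; _<_; s≤s; z≤n)
open import Data.Nat.Induction using (<-wellFounded)
open import Data.Nat.Properties using (<⇒≱; >⇒≢; ≤-<-trans; <-≤-trans; ≤-trans; <⇒≤)
open import Data.Product using (_×_; _,_; ∃-syntax; proj₁; proj₂)
open import Data.Sum using (_⊎_; inj₁; inj₂; [_,_]′)
open import Data.Vec.Base using (_∷_) renaming (here to hereᵥ; there to thereᵥ)
open import Function using (_∘_; id; _on_)
open import Induction.WellFounded using (Acc; acc)
import Relation.Binary.Construct.On as On
open import Relation.Binary.PropositionalEquality
  using (_≡_; _≢_; _≗_; refl; sym; trans; cong; subst; module ≡-Reasoning)
open import Relation.Nullary using (¬_; Dec; yes; no; does; contradiction)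

open import Defs hiding (sym)

private
  variable
    n : ℕ

x∈p─q⇒x∈p : ∀ {x : Fin n} {p q} → x ∈ p ─ q → x ∈ p
x∈p─q⇒x∈p = p─q⊆p _ _

x∈p─q⇒x∉q : ∀ {x : Fin n} {p q} → x ∈ p ─ q → x ∉ q
x∈p─q⇒x∉q {p = _ ∷ _} {true  ∷ _} ()         hereᵥ
x∈p─q⇒x∉q {p = _ ∷ _} {false ∷ _} hereᵥ      ()
x∈p─q⇒x∉q {p = _ ∷ _} {_     ∷ _} (thereᵥ a) (thereᵥ b) = x∈p─q⇒x∉q a b

x∈p∩q⇒x∈p : ∀ {x : Fin n} {p q} → x ∈ p ∩ q → x ∈ p
x∈p∩q⇒x∈p = proj₁ ∘ x∈p∩q⁻ _ _

x∈p∩q⇒x∈q : ∀ {x : Fin n} {p q} → x ∈ p ∩ q → x ∈ q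
x∈p∩q⇒x∈q = proj₂ ∘ x∈p∩q⁻ _ _

p─q≡∅⇒p⊆q : ∀ {p q : Subset n} → ¬ Nonempty (p ─ q) → p ⊆ q
p─q≡∅⇒p⊆q {q = q} p─q≡∅ {x} x∈p with x ∈? q
... | yes x∈q = x∈q
... | no  x∉q = contradiction (x , x∈p∧x∉q⇒x∈p─q x∈p x∉q) p─q≡∅

∣q∣<∣p∣⇒p─q≢∅ : ∀ {p q : Subset n} → ∣ q ∣ < ∣ p ∣ → Nonempty (p ─ q)
∣q∣<∣p∣⇒p─q≢∅ {p = p} {q} ∣q∣<∣p∣ with nonempty? (p ─ q)
... | yes p─q≢∅ = p─q≢∅
... | no  p─q≡∅ = contradiction (p⊆q⇒∣p∣≤∣q∣ (p─q≡∅⇒p⊆q p─q≡∅)) (<⇒≱ ∣q∣<∣p∣)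

0<∣p∣⇒p≢∅ : ∀ {p : Subset n} → 0 < ∣ p ∣ → Nonempty p
0<∣p∣⇒p≢∅ {n} {p} 0<∣p∣ with nonempty? p
... | yes p≢∅ = p≢∅
... | no  p≡∅ = contradiction (trans (cong ∣_∣ (Empty-unique p≡∅)) (∣⊥∣≡0 n)) (>⇒≢ 0<∣p∣)

∣p∣≡1+∣p-x∣ : ∀ (p : Subset n) {x} → x ∈ p → ∣ p ∣ ≡ suc ∣ p - x ∣
∣p∣≡1+∣p-x∣ (true  ∷ p) hereᵥ      = cong suc (cong ∣_∣ (sym (p─⊥≡p p)))
∣p∣≡1+∣p-x∣ (true  ∷ p) (thereᵥ x∈p) = cong suc (∣p∣≡1+∣p-x∣ p x∈p)
∣p∣≡1+∣p-x∣ (false ∷ p) (thereᵥ x∈p) = ∣p∣≡1+∣p-x∣ p x∈p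

∣p∪⁅x⁆∣≡1+∣p∣ : ∀ (p : Subset n) {x} → x ∉ p → ∣ p ∪ ⁅ x ⁆ ∣ ≡ suc ∣ p ∣
∣p∪⁅x⁆∣≡1+∣p∣ (true  ∷ p) {Fin.zero}  x∉p = contradiction hereᵥ x∉p
∣p∪⁅x⁆∣≡1+∣p∣ (false ∷ p) {Fin.zero}  x∉p = cong (suc ∘ ∣_∣) (∪-identityʳ p)
∣p∪⁅x⁆∣≡1+∣p∣ (true  ∷ p) {Fin.suc x} x∉p = cong suc (∣p∪⁅x⁆∣≡1+∣p∣ p (x∉p ∘ thereᵥ))
∣p∪⁅x⁆∣≡1+∣p∣ (false ∷ p) {Fin.suc x} x∉p = ∣p∪⁅x⁆∣≡1+∣p∣ p (x∉p ∘ thereᵥ)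

replace : Subset n → Fin n → Fin n → Subset n
replace X p q = (X - p) ∪ ⁅ q ⁆

module _ {X : Subset n} {p q : Fin n} where

  ∈-replace⁺ˡ : ∀ {z} → z ∈ X → z ≢ p → z ∈ replace X p q
  ∈-replace⁺ˡ z∈X z≢p = x∈p∪q⁺ (inj₁ (x∈p∧x∉q⇒x∈p─q z∈X (x≢y⇒x∉⁅y⁆ z≢p)))

  ∈-replace⁺ʳ : ∀ {z} → z ≡ q → z ∈ replace X p q
  ∈-replace⁺ʳ refl = x∈p∪q⁺ (inj₂ (x∈⁅x⁆ q))

  ∈-replace⁻ : ∀ {z} → z ∈ replace X p q → (z ∈ X × z ≢ p) ⊎ z ≡ q
  ∈-replace⁻ z∈ with x∈p∪q⁻ (X - p) ⁅ q ⁆ z∈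
  ... | inj₁ z∈X-p = inj₁ (x∈p─q⇒x∈p z∈X-p , x∉⁅y⁆⇒x≢y (x∈p─q⇒x∉q z∈X-p))
  ... | inj₂ z∈⁅q⁆ = inj₂ (x∈⁅y⁆⇒x≡y q z∈⁅q⁆)

  p∉replace : p ∈ X → q ∉ X → p ∉ replace X p q
  p∉replace p∈X q∉X p∈ with ∈-replace⁻ p∈
  ... | inj₁ (_ , p≢p) = p≢p refl
  ... | inj₂ refl      = q∉X p∈X

  ∣replace∣ : p ∈ X → q ∉ X → ∣ replace X p q ∣ ≡ ∣ X ∣
  ∣replace∣ p∈X q∉X = begin
    ∣ (X - p) ∪ ⁅ q ⁆ ∣ ≡⟨ ∣p∪⁅x⁆∣≡1+∣p∣ (X - p) (q∉X ∘ x∈p─q⇒x∈p) ⟩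
    suc ∣ X - p ∣       ≡⟨ sym (∣p∣≡1+∣p-x∣ X p∈X) ⟩
    ∣ X ∣               ∎
    where open ≡-Reasoning

replace-self : ∀ {X : Subset n} {x} → x ∈ X → replace X x x ≡ X
replace-self {X = X} {x} x∈X = ⊆-antisym to from
  where
  to : replace X x x ⊆ X
  to z∈ with ∈-replace⁻ z∈
  ... | inj₁ (z∈X , _) = z∈X
  ... | inj₂ refl      = x∈X
  from : X ⊆ replace X x x
  from {z} z∈X with z ≟ x
  ... | yes z≡x = ∈-replace⁺ʳ z≡x
  ... | no  z≢x = ∈-replace⁺ˡ z∈X z≢x

replace-trans : ∀ {X : Subset n} {p x q} → x ∉ X → replace (replace X p x) x q ≡ replace X p q
replace-trans {X = X} {p} {x} {q} x∉X = ⊆-antisym to from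
  where
  to : replace (replace X p x) x q ⊆ replace X p q
  to z∈ with ∈-replace⁻ z∈
  ... | inj₂ z≡q = ∈-replace⁺ʳ z≡q
  ... | inj₁ (z∈ , z≢x) with ∈-replace⁻ z∈
  ...   | inj₁ (z∈X , z≢p) = ∈-replace⁺ˡ z∈X z≢p
  ...   | inj₂ z≡x        = contradiction z≡x z≢x
  from : replace X p q ⊆ replace (replace X p x) x q
  from z∈ with ∈-replace⁻ z∈
  ... | inj₂ z≡q         = ∈-replace⁺ʳ z≡q
  ... | inj₁ (z∈X , z≢p) = ∈-replace⁺ˡ (∈-replace⁺ˡ z∈X z≢p) λ { refl → x∉X z∈X }

replace-shift : ∀ {X : Subset n} {p x q} → p ∈ X → x ∈ X → x ≢ p → q ∉ X →
                replace (replace X x q) p x ≡ replace X p q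
replace-shift {X = X} {p} {x} {q} p∈X x∈X x≢p q∉X = ⊆-antisym to from
  where
  to : replace (replace X x q) p x ⊆ replace X p q
  to z∈ with ∈-replace⁻ z∈
  ... | inj₂ refl = ∈-replace⁺ˡ x∈X x≢p
  ... | inj₁ (z∈ , z≢p) with ∈-replace⁻ z∈
  ...   | inj₁ (z∈X , _) = ∈-replace⁺ˡ z∈X z≢p
  ...   | inj₂ z≡q       = ∈-replace⁺ʳ z≡q
  from : replace X p q ⊆ replace (replace X x q) p x
  from {z} z∈ with ∈-replace⁻ z∈
  ... | inj₂ refl = ∈-replace⁺ˡ (∈-replace⁺ʳ refl) λ { refl → q∉X p∈X }
  ... | inj₁ (z∈X , z≢p) with z ≟ x
  ...   | yes z≡x = ∈-replace⁺ʳ z≡x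
  ...   | no  z≢x = ∈-replace⁺ˡ (∈-replace⁺ˡ z∈X z≢x) z≢p

MapsTo : (Fin n → Fin n) → Subset n → Subset n → Set
MapsTo f A B = ∀ x → x ∈ A → f x ∈ B

InjectiveOn : (Fin n → Fin n) → Subset n → Set
InjectiveOn f A = ∀ x y → x ∈ A → y ∈ A → f x ≡ f y → x ≡ y

Onto : (Fin n → Fin n) → Subset n → Subset n → Set
Onto f A B = ∀ y → y ∈ B → ∃[ x ] (x ∈ A × f x ≡ y)

Agree : Subset n → (Fin n → Fin n) → (Fin n → Fin n) → Set
Agree A f g = ∀ x → x ∈ A → f x ≡ g x

record BijOn (f : Fin n → Fin n) (A B : Subset n) : Set where
  field
    mapsTo    : MapsTo f A B
    injective : InjectiveOn f A
    onto      : Onto f A B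

injectiveOn-∘ : ∀ {f g : Fin n → Fin n} {A B} →
                MapsTo f A B → InjectiveOn f A → InjectiveOn g B → InjectiveOn (g ∘ f) A
injectiveOn-∘ f↦ f-inj g-inj x y x∈A y∈A gfx≡gfy =
  f-inj x y x∈A y∈A (g-inj _ _ (f↦ x x∈A) (f↦ y y∈A) gfx≡gfy)

module _ {f g : Fin n → Fin n} {A B C : Subset n} where

  mapsTo-∘ : MapsTo f A B → MapsTo g B C → MapsTo (g ∘ f) A C
  mapsTo-∘ f↦ g↦ x x∈A = g↦ (f x) (f↦ x x∈A)

  onto-∘ : Onto f A B → Onto g B C → Onto (g ∘ f) A C
  onto-∘ f-onto g-onto z z∈C with g-onto z z∈C
  ... | y , y∈B , refl with f-onto y y∈B
  ...   | x , x∈A , refl = x , x∈A , refl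

  bijOn-∘ : BijOn f A B → BijOn g B C → BijOn (g ∘ f) A C
  bijOn-∘ f-bij g-bij = record
    { mapsTo    = mapsTo-∘ F.mapsTo G.mapsTo
    ; injective = injectiveOn-∘ F.mapsTo F.injective G.injective
    ; onto      = onto-∘ F.onto G.onto
    }
    where
    module F = BijOn f-bij
    module G = BijOn g-bij

bijOn-id : ∀ {A : Subset n} → BijOn id A A
bijOn-id = record
  { mapsTo = λ _ x∈A → x∈A ; injective = λ _ _ _ _ x≡y → x≡y ; onto = λ y y∈A → y , y∈A , refl }

bijOn-resp : ∀ {f g : Fin n → Fin n} {A B} → Agree A f g → BijOn f A B → BijOn g A B
bijOn-resp {A = A} {B} f≈g f-bij = record
  { mapsTo    = λ x x∈A → subst (_∈ B) (f≈g x x∈A) (mapsTo x x∈A)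
  ; injective = λ x y x∈A y∈A gx≡gy →
      injective x y x∈A y∈A (trans (f≈g x x∈A) (trans gx≡gy (sym (f≈g y y∈A))))
  ; onto      = λ y y∈B → let (x , x∈A , fx≡y) = onto y y∈B
                          in x , x∈A , trans (sym (f≈g x x∈A)) fx≡y
  }
  where open BijOn f-bij

module _ {f : Fin n → Fin n} {A B : Subset n} (f-onto : Onto f A B) where

  section : Fin n → Fin n
  section y with y ∈? B
  ... | yes y∈B = proj₁ (f-onto y y∈B)
  ... | no  _   = y

  section-mapsTo : MapsTo section B A
  section-mapsTo y y∈B with y ∈? B
  ... | yes y∈B′ = proj₁ (proj₂ (f-onto y y∈B′))
  ... | no  y∉B  = contradiction y∈B y∉B

  section-inverse : Agree B (f ∘ section) id
  section-inverse y y∈B with y ∈? B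
  ... | yes y∈B′ = proj₂ (proj₂ (f-onto y y∈B′))
  ... | no  y∉B  = contradiction y∈B y∉B

  section-injective : InjectiveOn section B
  section-injective x y x∈B y∈B sx≡sy =
    trans (sym (section-inverse x x∈B)) (trans (cong f sx≡sy) (section-inverse y y∈B))

isPermOn-∘ : ∀ {W : Subset n} {π σ} → IsPermOn W π → IsPermOn W σ → IsPermOn W (σ ∘ π)
isPermOn-∘ (π↦ , π-inj) (σ↦ , σ-inj) = mapsTo-∘ π↦ σ↦ , injectiveOn-∘ π↦ π-inj σ-inj

idOutside : Subset n → (Fin n → Fin n) → Fin n → Fin n
idOutside A g x = if does (x ∈? A) then g x else x

idOutside-∈ : ∀ {A : Subset n} {g x} → x ∈ A → idOutside A g x ≡ g x
idOutside-∈ {A = A} {x = x} x∈A with x ∈? A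
... | yes _   = refl
... | no  x∉A = contradiction x∈A x∉A

idOutside-∉ : ∀ {A : Subset n} {g x} → x ∉ A → idOutside A g x ≡ x
idOutside-∉ {A = A} {x = x} x∉A with x ∈? A
... | yes x∈A = contradiction x∈A x∉A
... | no  _   = refl

-- Transpositions generate the symmetric group
transpose-matchˡ : ∀ (i j : Fin n) → transpose i j i ≡ j
transpose-matchˡ i j with i ≟ i
... | yes _   = refl
... | no  i≢i = contradiction refl i≢i

transpose-matchʳ : ∀ (i j : Fin n) → transpose i j j ≡ i
transpose-matchʳ i j with j ≟ i
... | yes j≡i = j≡i
... | no  _ with j ≟ j
...   | yes _   = refl
...   | no  j≢j = contradiction refl j≢j

transpose-other : ∀ {i j k : Fin n} → k ≢ i → k ≢ j → transpose i j k ≡ k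
transpose-other {i = i} {j} {k} k≢i k≢j with k ≟ i
... | yes k≡i = contradiction k≡i k≢i
... | no  _ with k ≟ j
...   | yes k≡j = contradiction k≡j k≢j
...   | no  _   = refl

transpose-isPermOn : ∀ {W : Subset n} {i j} → i ∈ W → j ∈ W → IsPermOn W (transpose i j)
transpose-isPermOn {W = W} {i} {j} i∈W j∈W = mapsTo , injective
  where
  mapsTo : MapsTo (transpose i j) W W
  mapsTo k k∈W with k ≟ i
  ... | yes _ = j∈W
  ... | no  _ with k ≟ j
  ...   | yes _ = i∈W
  ...   | no  _ = k∈W
  injective : InjectiveOn (transpose i j) W
  injective a b _ _ τa≡τb = begin
    a                               ≡⟨ sym (transpose-inverse j i) ⟩
    transpose j i (transpose i j a) ≡⟨ cong (transpose j i) τa≡τb ⟩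
    transpose j i (transpose i j b) ≡⟨ transpose-inverse j i ⟩
    b                               ∎
    where open ≡-Reasoning

transpose-conjugate : ∀ {x y c : Fin n} → x ≢ c → y ≢ c → x ≢ y →
                      transpose x c ∘ transpose c y ∘ transpose x c ≗ transpose x y
transpose-conjugate {x = x} {y} {c} x≢c y≢c x≢y z = cases (z ≟ x) (z ≟ c) (z ≟ y)
  where
  cases : Dec (z ≡ x) → Dec (z ≡ c) → Dec (z ≡ y) →
          transpose x c (transpose c y (transpose x c z)) ≡ transpose x y z
  cases (yes refl) _ _
    rewrite transpose-matchˡ z c | transpose-matchˡ c y
          | transpose-other {i = z} {c} (x≢y ∘ sym) y≢c | transpose-matchˡ z y = refl
  cases (no _) (yes refl) _
    rewrite transpose-matchʳ x z | transpose-other {i = z} {y} x≢c x≢y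
          | transpose-matchˡ x z | transpose-other {i = x} {y} (x≢c ∘ sym) (y≢c ∘ sym) = refl
  cases (no _) (no _) (yes refl)
    rewrite transpose-other {i = x} {c} (x≢y ∘ sym) y≢c | transpose-matchʳ c z
          | transpose-matchʳ x c | transpose-matchʳ x z = refl
  cases (no z≢x) (no z≢c) (no z≢y)
    rewrite transpose-other {i = x} {c} z≢x z≢c | transpose-other {i = c} {y} z≢c z≢y
          | transpose-other {i = x} {c} z≢x z≢c | transpose-other {i = x} {y} z≢x z≢y = refl

Realised : Subset n → ((Fin n → Fin n) → Set) → (Fin n → Fin n) → Set
Realised W G π = ∃[ f ] (G f × Agree W f π)

module Generation {n} {W : Subset n} {G : (Fin n → Fin n) → Set}
                  (G-id : G id) (G-∘ : ∀ {f g} → G f → G g → G (g ∘ f)) where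

  realised-resp : ∀ {π σ} → Agree W π σ → Realised W G π → Realised W G σ
  realised-resp π≈σ (f , Gf , f≈π) = f , Gf , λ x x∈W → trans (f≈π x x∈W) (π≈σ x x∈W)

  realised-∘ : ∀ {π σ} → MapsTo π W W → Realised W G π → Realised W G σ → Realised W G (σ ∘ π)
  realised-∘ π↦ (f , Gf , f≈π) (g , Gg , g≈σ) =
    g ∘ f , G-∘ Gf Gg , λ x x∈W → trans (cong g (f≈π x x∈W)) (g≈σ _ (π↦ x x∈W))

  realised-transpose-via : ∀ {x y c} → x ∈ W → y ∈ W → c ∈ W → x ≢ c → y ≢ c → x ≢ y →
    Realised W G (transpose x c) → Realised W G (transpose c y) → Realised W G (transpose x y)
  realised-transpose-via x∈W y∈W c∈W x≢c y≢c x≢y τxc τcy =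
    realised-resp (λ z _ → transpose-conjugate x≢c y≢c x≢y z)
      (realised-∘ (proj₁ (isPermOn-∘ τxc-perm τcy-perm)) (realised-∘ (proj₁ τxc-perm) τxc τcy) τxc)
    where
    τxc-perm = transpose-isPermOn x∈W c∈W
    τcy-perm = transpose-isPermOn c∈W y∈W

  module _ (transpositions : ∀ x y → x ∈ W → y ∈ W → Realised W G (transpose x y)) where

    realised-fixing-outside : ∀ (L : List (Fin n)) π → IsPermOn W π →
                      (∀ z → z ∈ W → z ∉ₗ L → π z ≡ z) → Realised W G π
    realised-fixing-outside [] π _ π-fix = id , G-id , λ z z∈W → sym (π-fix z z∈W λ ())
    realised-fixing-outside (x ∷ L) π π-perm π-fix with x ∈? W
    ... | no x∉W = realised-fixing-outside L π π-perm λ z z∈W z∉L →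
          π-fix z z∈W λ { (here refl) → x∉W z∈W ; (there z∈L) → z∉L z∈L }
    ... | yes x∈W = realised-resp (λ z _ → transpose-inverse x y)
                      (realised-∘ (proj₁ π′-perm) (realised-fixing-outside L π′ π′-perm π′-fix)
                                  (transpositions x y x∈W y∈W))
      where
      y  = π x
      y∈W = proj₁ π-perm x x∈W
      π′ = transpose y x ∘ π
      π′-perm : IsPermOn W π′
      π′-perm = isPermOn-∘ π-perm (transpose-isPermOn y∈W x∈W)
      π′-fix : ∀ z → z ∈ W → z ∉ₗ L → π′ z ≡ z
      π′-fix z z∈W z∉L with z ≟ x
      ... | yes refl = transpose-matchˡ y z
      ... | no  z≢x  = trans (cong (transpose y x) πz≡z) (transpose-other z≢y z≢x)
        where
        πz≡z : π z ≡ z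
        πz≡z = π-fix z z∈W λ { (here z≡x) → z≢x z≡x ; (there z∈L) → z∉L z∈L }
        z≢y : z ≢ y
        z≢y z≡y = z≢x (proj₂ π-perm z x z∈W x∈W (trans πz≡z z≡y))

    transpositions⇒permutations : ∀ π → IsPermOn W π → Realised W G π
    transpositions⇒permutations π π-perm =
      realised-fixing-outside (allFin n) π π-perm λ z _ z∉ → contradiction (∈-allFin z) z∉

flow-mono : ∀ {E E′ : Fin n → Fin n → Set} → (∀ {u v} → E u v → E′ u v) →
            ∀ {s} → Flow E s → Flow E′ s
flow-mono E⇒E′ (gen e)    = gen (E⇒E′ e)
flow-mono E⇒E′ (comp s t) = comp (flow-mono E⇒E′ s) (flow-mono E⇒E′ t)

defect-mapsTo : ∀ {E : Fin n → Fin n → Set} {W Vk f} → DefectGroup E W Vk f → MapsTo f W W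
defect-mapsTo (gen _ (s↦ , _)) = s↦
defect-mapsTo one               = λ _ x∈W → x∈W
defect-mapsTo (comp f g)        = mapsTo-∘ (defect-mapsTo f) (defect-mapsTo g)
defect-mapsTo (inv _ g↦ _)      = g↦

collapse-source : ∀ (u v : Fin n) → collapse u v u ≡ v
collapse-source u v with u ≟ u
... | yes _   = refl
... | no  u≢u = contradiction refl u≢u

collapse-other : ∀ {u v x : Fin n} → x ≢ u → collapse u v x ≡ x
collapse-other {u = u} {x = x} x≢u with x ≟ u
... | yes x≡u = contradiction x≡u x≢u
... | no  _   = refl

collapse-injectiveOn : ∀ {A : Subset n} {q x} → x ∉ A → InjectiveOn (collapse q x) A
collapse-injectiveOn {A = A} {q} x∉A a b a∈A b∈A eq with a ≟ q | b ≟ q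
... | yes a≡q | yes b≡q = trans a≡q (sym b≡q)
... | yes _   | no  _   = contradiction (subst (_∈ A) (sym eq) b∈A) x∉A
... | no  _   | yes _   = contradiction (subst (_∈ A) eq a∈A) x∉A
... | no  _   | no  _   = eq

data Flow¹ (E : Fin n → Fin n → Set) : (Fin n → Fin n) → Set where
  identity : Flow¹ E id
  flow     : ∀ {s} → Flow E s → Flow¹ E s

flow¹-∘ʳ : ∀ {E : Fin n → Fin n → Set} {s t} → Flow¹ E s → Flow E t → Flow E (t ∘ s)
flow¹-∘ʳ identity t   = t
flow¹-∘ʳ (flow s) t   = comp s t

flow¹-∘ : ∀ {E : Fin n → Fin n → Set} {s t} → Flow¹ E s → Flow¹ E t → Flow¹ E (t ∘ s)
flow¹-∘ s identity = s
flow¹-∘ s (flow t) = flow (flow¹-∘ʳ s t)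

path-map : ∀ {E E′ : Fin n → Fin n → Set} → (∀ {u v} → E u v → E′ u v) →
           ∀ {a b} → Path E a b → Path E′ a b
path-map E⇒E′ here       = here
path-map E⇒E′ (step e p) = step (E⇒E′ e) (path-map E⇒E′ p)

_++ᵖ_ : ∀ {E : Fin n → Fin n → Set} {a b c} → Path E a b → Path E b c → Path E a c
here       ++ᵖ q = q
step e p ++ᵖ q = step e (p ++ᵖ q)

path-leaves : ∀ {E : Fin n → Fin n → Set} {R : Subset n} {a b} → Path E a b → a ∈ R → b ∉ R →
              ∃[ p ] ∃[ y ] (E p y × p ∈ R × y ∉ R)
path-leaves here a∈R a∉R = contradiction a∈R a∉R
path-leaves {R = R} (step {v = v} e p) a∈R b∉R with v ∈? R
... | yes v∈R = path-leaves p v∈R b∉R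
... | no  v∉R = _ , v , e , a∈R , v∉R

-- Defect groups of subgraphs and of their unions
module _ {Γ : Graph n} where

  _⊑_ : Subgraph Γ → Subgraph Γ → Set
  H₁ ⊑ H = Vs H₁ ⊆ Vs H × (∀ {u v} → Es H₁ u v → Es H u v)

  ∪ᴳ-upperˡ : ∀ {H₁ H₂ : Subgraph Γ} → H₁ ⊑ (H₁ ∪ᴳ H₂)
  ∪ᴳ-upperˡ = (λ x∈ → x∈p∪q⁺ (inj₁ x∈)) , inj₁

  ∪ᴳ-upperʳ : ∀ {H₁ H₂ : Subgraph Γ} → H₂ ⊑ (H₁ ∪ᴳ H₂)
  ∪ᴳ-upperʳ = (λ x∈ → x∈p∪q⁺ (inj₂ x∈)) , inj₂

  Defect : Subgraph Γ → Subset n → (Fin n → Fin n) → Set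
  Defect H Vk = DefectGroup (Es H) (Vs H ─ Vk) Vk

  FullAt : Subgraph Γ → ℕ → Subset n → Set
  FullAt H k A = ∀ Vk → Vk ⊆ A → ∣ Vk ∣ ≡ k → DefectFull H Vk

  module _ (H : Subgraph Γ) where

    flow-mapsTo : ∀ {s} → Flow (Es H) s → MapsTo s (Vs H) (Vs H)
    flow-mapsTo (gen {u} {v} e) x x∈ with x ≟ u
    ... | yes _ = Es-tgt H e
    ... | no  _ = x∈
    flow-mapsTo (comp s t) = mapsTo-∘ (flow-mapsTo s) (flow-mapsTo t)

    flow-fixes-outside : ∀ {s} → Flow (Es H) s → ∀ x → x ∉ Vs H → s x ≡ x
    flow-fixes-outside (gen e) x x∉ = collapse-other λ { refl → x∉ (Es-src H e) }
    flow-fixes-outside (comp {t = t} s₁ s₂) x x∉ =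
      trans (cong t (flow-fixes-outside s₁ x x∉)) (flow-fixes-outside s₂ x x∉)

  module Lift {H₁ H : Subgraph Γ} (H₁⊑H : H₁ ⊑ H) {Vk : Subset n} where

    private
      V₁ = Vs H₁
      W₁ = Vs H₁ ─ Vk
      W  = Vs H ─ Vk

    W₁⊆W : W₁ ⊆ W
    W₁⊆W x∈W₁ = x∈p∧x∉q⇒x∈p─q (proj₁ H₁⊑H (x∈p─q⇒x∈p x∈W₁)) (x∈p─q⇒x∉q x∈W₁)

    ∈W₁ : ∀ {x} → x ∈ W → x ∈ V₁ → x ∈ W₁
    ∈W₁ x∈W x∈V₁ = x∈p∧x∉q⇒x∈p─q x∈V₁ (x∈p─q⇒x∉q x∈W)

    lift-admissible : ∀ {s} → Flow (Es H₁) s → Admissible W₁ Vk s → Admissible W Vk s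
    lift-admissible {s} s-flow (s↦ , s-onto , s-Vk) = mapsTo , onto , λ x x∈Vk → W₁⊆W (s-Vk x x∈Vk)
      where
      mapsTo : MapsTo s W W
      mapsTo x x∈W with x ∈? V₁
      ... | yes x∈V₁ = W₁⊆W (s↦ x (∈W₁ x∈W x∈V₁))
      ... | no  x∉V₁ = subst (_∈ W) (sym (flow-fixes-outside H₁ s-flow x x∉V₁)) x∈W
      onto : Onto s W W
      onto y y∈W with y ∈? V₁
      ... | no  y∉V₁ = y , y∈W , flow-fixes-outside H₁ s-flow y y∉V₁
      ... | yes y∈V₁ with s-onto y (∈W₁ y∈W y∈V₁)
      ...   | x , x∈W₁ , sx≡y = x , W₁⊆W x∈W₁ , sx≡y

    Lifted : (Fin n → Fin n) → Set
    Lifted g = ∃[ g′ ] (Defect H Vk g′ × Agree W₁ g′ g × (∀ x → x ∉ V₁ → g′ x ≡ x))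

    lift-defect : ∀ {g} → Defect H₁ Vk g → Lifted g
    lift-defect (gen s-flow s-adm) =
      _ , gen (flow-mono (proj₂ H₁⊑H) s-flow) (lift-admissible s-flow s-adm)
        , (λ _ _ → refl) , flow-fixes-outside H₁ s-flow
    lift-defect one = id , one , (λ _ _ → refl) , (λ _ _ → refl)
    lift-defect (comp f g) with lift-defect f | lift-defect g
    ... | f′ , f′-def , f′≈f , f′-fix | g′ , g′-def , g′≈g , g′-fix =
      g′ ∘ f′ , comp f′-def g′-def
      , (λ x x∈W₁ → trans (cong g′ (f′≈f x x∈W₁)) (g′≈g _ (defect-mapsTo f x x∈W₁)))
      , (λ x x∉V₁ → trans (cong g′ (f′-fix x x∉V₁)) (g′-fix x x∉V₁))
    lift-defect (inv {f} {g} f-def g↦ f∘g≈id) with lift-defect f-def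
    ... | f′ , f′-def , f′≈f , f′-fix =
      g′ , inv f′-def g′↦ f′∘g′≈id , (λ x x∈W₁ → idOutside-∈ {g = g} (x∈p─q⇒x∈p x∈W₁))
      , λ x → idOutside-∉ {g = g}
      where
      g′ = idOutside V₁ g
      g′↦ : MapsTo g′ W W
      g′↦ x x∈W with x ∈? V₁
      ... | yes x∈V₁ = W₁⊆W (g↦ x (∈W₁ x∈W x∈V₁))
      ... | no  _    = x∈W
      f′∘g′≈id : Agree W (f′ ∘ g′) id
      f′∘g′≈id x x∈W with x ∈? V₁
      ... | yes x∈V₁ = trans (f′≈f (g x) (g↦ x (∈W₁ x∈W x∈V₁))) (f∘g≈id x (∈W₁ x∈W x∈V₁))
      ... | no  x∉V₁ = f′-fix x x∉V₁

    lift-transposition : DefectFull H₁ Vk → ∀ {x y} → x ∈ W₁ → y ∈ W₁ →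
                         Realised W (Defect H Vk) (transpose x y)
    lift-transposition full₁ {x} {y} x∈W₁ y∈W₁
      with full₁ (transpose x y) (transpose-isPermOn x∈W₁ y∈W₁)
    ... | g , g-def , g≈τ with lift-defect g-def
    ...   | g′ , g′-def , g′≈g , g′-fix = g′ , g′-def , agree
      where
      agree : Agree W g′ (transpose x y)
      agree z z∈W with z ∈? V₁
      ... | yes z∈V₁ = trans (g′≈g z (∈W₁ z∈W z∈V₁)) (g≈τ z (∈W₁ z∈W z∈V₁))
      ... | no  z∉V₁ = trans (g′-fix z z∉V₁) (sym (transpose-other
                         (λ { refl → z∉V₁ (x∈p─q⇒x∈p x∈W₁) }) (λ { refl → z∉V₁ (x∈p─q⇒x∈p y∈W₁) })))

  module _ {H₁ H₂ : Subgraph Γ} {Vk c} (c∈V₁ : c ∈ Vs H₁) (c∈V₂ : c ∈ Vs H₂) (c∉Vk : c ∉ Vk)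
           (full₁ : DefectFull H₁ Vk) (full₂ : DefectFull H₂ Vk) where

    private
      V₁ = Vs H₁
      V₂ = Vs H₂
      W  = Vs (H₁ ∪ᴳ H₂) ─ Vk
      module L₁ = Lift {H₁} {H₁ ∪ᴳ H₂} (∪ᴳ-upperˡ {H₁ = H₁} {H₂}) {Vk}
      module L₂ = Lift {H₂} {H₁ ∪ᴳ H₂} (∪ᴳ-upperʳ {H₁ = H₁} {H₂}) {Vk}
      open Generation {W = W} {Defect (H₁ ∪ᴳ H₂) Vk} one comp
      c∈W : c ∈ W
      c∈W = x∈p∧x∉q⇒x∈p─q (x∈p∪q⁺ (inj₁ c∈V₁)) c∉Vk
      outside-both : ∀ {z} → z ∉ V₁ → z ∉ V₂ → z ∉ W
      outside-both z∉V₁ z∉V₂ z∈W = [ z∉V₁ , z∉V₂ ]′ (x∈p∪q⁻ V₁ V₂ (x∈p─q⇒x∈p z∈W))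
      Realised∪ : (Fin n → Fin n) → Set
      Realised∪ = Realised W (Defect (H₁ ∪ᴳ H₂) Vk)
      in₁ : ∀ {x y} → x ∈ W → x ∈ V₁ → y ∈ W → y ∈ V₁ → Realised∪ (transpose x y)
      in₁ x∈W x∈V₁ y∈W y∈V₁ = L₁.lift-transposition full₁ (L₁.∈W₁ x∈W x∈V₁) (L₁.∈W₁ y∈W y∈V₁)
      in₂ : ∀ {x y} → x ∈ W → x ∈ V₂ → y ∈ W → y ∈ V₂ → Realised∪ (transpose x y)
      in₂ x∈W x∈V₂ y∈W y∈V₂ = L₂.lift-transposition full₂ (L₂.∈W₁ x∈W x∈V₂) (L₂.∈W₁ y∈W y∈V₂)

    ∪ᴳ-transposition : ∀ {x y} → x ∈ W → y ∈ W → Realised W (Defect (H₁ ∪ᴳ H₂) Vk) (transpose x y)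
    ∪ᴳ-transposition {x} {y} x∈W y∈W with x ∈? V₁ | y ∈? V₁ | x ∈? V₂ | y ∈? V₂
    ... | yes x∈V₁ | yes y∈V₁ | _        | _        = in₁ x∈W x∈V₁ y∈W y∈V₁
    ... | _        | _        | yes x∈V₂ | yes y∈V₂ = in₂ x∈W x∈V₂ y∈W y∈V₂
    ... | _        | no y∉V₁  | _        | no y∉V₂  = contradiction y∈W (outside-both y∉V₁ y∉V₂)
    ... | no x∉V₁  | _        | no x∉V₂  | _        = contradiction x∈W (outside-both x∉V₁ x∉V₂)
    ... | yes x∈V₁ | no y∉V₁  | no x∉V₂  | yes y∈V₂ =
      realised-transpose-via x∈W y∈W c∈W (λ { refl → x∉V₂ c∈V₂ }) (λ { refl → y∉V₁ c∈V₁ })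
        (λ { refl → y∉V₁ x∈V₁ }) (in₁ x∈W x∈V₁ c∈W c∈V₁) (in₂ c∈W c∈V₂ y∈W y∈V₂)
    ... | no x∉V₁  | yes y∈V₁ | yes x∈V₂ | no y∉V₂  =
      realised-transpose-via x∈W y∈W c∈W (λ { refl → x∉V₁ c∈V₁ }) (λ { refl → y∉V₂ c∈V₂ })
        (λ { refl → y∉V₂ x∈V₂ }) (in₂ x∈W x∈V₂ c∈W c∈V₂) (in₁ c∈W c∈V₁ y∈W y∈V₁)

    ∪ᴳ-defectFull : DefectFull (H₁ ∪ᴳ H₂) Vk
    ∪ᴳ-defectFull = transpositions⇒permutations (λ x y → ∪ᴳ-transposition {x} {y})

  module _ {H₁ H₂ : Subgraph Γ} where

    ∪ᴳ-connected : ∀ {c} → Connected H₁ → Connected H₂ → c ∈ Vs H₁ → c ∈ Vs H₂ →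
                   Connected (H₁ ∪ᴳ H₂)
    ∪ᴳ-connected {c} conn₁ conn₂ c∈V₁ c∈V₂ u v u∈ v∈ = to-c u u∈ ++ᵖ from-c v v∈
      where
      to-c : ∀ u → u ∈ Vs (H₁ ∪ᴳ H₂) → Path (Es (H₁ ∪ᴳ H₂)) u c
      to-c u u∈ with x∈p∪q⁻ (Vs H₁) (Vs H₂) u∈
      ... | inj₁ u∈V₁ = path-map inj₁ (conn₁ u c u∈V₁ c∈V₁)
      ... | inj₂ u∈V₂ = path-map inj₂ (conn₂ u c u∈V₂ c∈V₂)
      from-c : ∀ v → v ∈ Vs (H₁ ∪ᴳ H₂) → Path (Es (H₁ ∪ᴳ H₂)) c v
      from-c v v∈ with x∈p∪q⁻ (Vs H₁) (Vs H₂) v∈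
      ... | inj₁ v∈V₁ = path-map inj₁ (conn₁ c v c∈V₁ v∈V₁)
      ... | inj₂ v∈V₂ = path-map inj₂ (conn₂ c v c∈V₂ v∈V₂)

    ∪ᴳ-fullAt : ∀ {k} → k < ∣ Vs H₁ ∩ Vs H₂ ∣ → FullAt H₁ k (Vs H₁) → FullAt H₂ k (Vs H₂) →
                FullAt (H₁ ∪ᴳ H₂) k (Vs H₁ ∩ Vs H₂)
    ∪ᴳ-fullAt k<∣I∣ full₁ full₂ Vk Vk⊆I ∣Vk∣≡k
      with ∣q∣<∣p∣⇒p─q≢∅ {p = Vs H₁ ∩ Vs H₂} {Vk} (subst (_< ∣ Vs H₁ ∩ Vs H₂ ∣) (sym ∣Vk∣≡k) k<∣I∣)
    ... | c , c∈I─Vk =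
      ∪ᴳ-defectFull {H₁ = H₁} {H₂} c∈V₁ c∈V₂ (x∈p─q⇒x∉q c∈I─Vk)
        (full₁ Vk (λ x∈ → x∈p∩q⇒x∈p (Vk⊆I x∈)) ∣Vk∣≡k)
        (full₂ Vk (λ x∈ → x∈p∩q⇒x∈q (Vk⊆I x∈)) ∣Vk∣≡k)
      where
      c∈V₁ = x∈p∩q⇒x∈p (x∈p─q⇒x∈p c∈I─Vk)
      c∈V₂ = x∈p∩q⇒x∈q (x∈p─q⇒x∈p c∈I─Vk)

-- Independence of the defect group from V_k
module Sliding {Γ : Graph n} (H : Subgraph Γ) where

  private
    U = Vs H
    E = Es H

  flow¹-mapsTo : ∀ {s} → Flow¹ E s → MapsTo s U U
  flow¹-mapsTo identity = λ _ x∈U → x∈U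
  flow¹-mapsTo (flow s) = flow-mapsTo H s

  Slide : Subset n → Subset n → Set
  Slide X Y = ∃[ m ] (Flow¹ E m × BijOn m (U ─ X) (U ─ Y))

  _⇄_ : Subset n → Subset n → Set
  X ⇄ Y = Slide X Y × Slide Y X

  slide-trans : ∀ {X Y Z} → Slide X Y → Slide Y Z → Slide X Z
  slide-trans (s , s-flow , s-bij) (t , t-flow , t-bij) =
    t ∘ s , flow¹-∘ s-flow t-flow , bijOn-∘ s-bij t-bij

  ⇄-refl : ∀ {X} → X ⇄ X
  ⇄-refl = (id , identity , bijOn-id) , (id , identity , bijOn-id)

  ⇄-trans : ∀ {X Y Z} → X ⇄ Y → Y ⇄ Z → X ⇄ Z
  ⇄-trans (X→Y , Y→X) (Y→Z , Z→Y) = slide-trans X→Y Y→Z , slide-trans Z→Y Y→X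

  collapse-slide : ∀ {X q x} → E q x → x ∈ X → q ∉ X → Slide X (replace X x q)
  collapse-slide {X} {q} {x} e x∈X q∉X =
    collapse q x , flow (gen e)
    , record { mapsTo    = mapsTo
             ; injective = collapse-injectiveOn (λ x∈ → x∈p─q⇒x∉q x∈ x∈X)
             ; onto      = onto }
    where
    Y = replace X x q
    mapsTo : MapsTo (collapse q x) (U ─ X) (U ─ Y)
    mapsTo z z∈ with z ≟ q
    ... | yes _   = x∈p∧x∉q⇒x∈p─q (Es-tgt H e) (p∉replace x∈X q∉X)
    ... | no  z≢q = x∈p∧x∉q⇒x∈p─q (x∈p─q⇒x∈p z∈)
                      λ z∈Y → [ (λ (z∈X , _) → x∈p─q⇒x∉q z∈ z∈X) , z≢q ]′ (∈-replace⁻ z∈Y)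
    onto : Onto (collapse q x) (U ─ X) (U ─ Y)
    onto y y∈ with y ≟ x
    ... | yes refl = q , x∈p∧x∉q⇒x∈p─q (Es-src H e) q∉X , collapse-source q y
    ... | no  y≢x  = y , x∈p∧x∉q⇒x∈p─q (x∈p─q⇒x∈p y∈) (λ y∈X → x∈p─q⇒x∉q y∈ (∈-replace⁺ˡ y∈X y≢x))
                       , collapse-other λ { refl → x∈p─q⇒x∉q y∈ (∈-replace⁺ʳ refl) }

  collapse-⇄ : ∀ {X q x} → E q x → x ∈ X → q ∉ X → X ⇄ replace X x q
  collapse-⇄ {X} {q} {x} e x∈X q∉X =
    collapse-slide e x∈X q∉X
    , subst (Slide (replace X x q)) (trans (replace-trans q∉X) (replace-self x∈X))
        (collapse-slide (Es-sym H e) (∈-replace⁺ʳ refl) (p∉replace x∈X q∉X))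

  path-⇄ : ∀ {X q p} → Path E q p → q ∉ X → p ∈ X → X ⇄ replace X p q
  path-⇄ here q∉X q∈X = contradiction q∈X q∉X
  path-⇄ {X} {q} {p} (step {v = x} e rest) q∉X p∈X with x ∈? X
  ... | no x∉X = subst (X ⇄_) (replace-trans x∉X)
                   (⇄-trans (path-⇄ rest x∉X p∈X) (collapse-⇄ e (∈-replace⁺ʳ refl) q∉X′))
    where
    q∉X′ : q ∉ replace X p x
    q∉X′ q∈ = [ (λ (q∈X , _) → q∉X q∈X) , (λ { refl → irrefl Γ (Es⊆E H e) }) ]′ (∈-replace⁻ q∈)
  ... | yes x∈X with x ≟ p
  ...   | yes refl = collapse-⇄ e x∈X q∉X
  ...   | no  x≢p  = subst (X ⇄_) (replace-shift p∈X x∈X x≢p q∉X)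
                       (⇄-trans (collapse-⇄ e x∈X q∉X)
                                (path-⇄ rest (p∉replace x∈X q∉X) (∈-replace⁺ˡ p∈X (x≢p ∘ sym))))

  Evacuation : Subset n → Set
  Evacuation Y = ∃[ z ] (Flow¹ E z × (∀ x → x ∉ Y → z x ≡ x) × MapsTo z Y (U ─ Y))

  record Move (X Y : Subset n) : Set where
    field
      fun       : Fin n → Fin n
      isFlow    : Flow E fun
      bijOn     : BijOn fun (U ─ X) (U ─ Y)
      evacuates : MapsTo fun X (U ─ Y)

  slide⇒move : ∀ {X Y y} → X ⊆ U → y ∈ Y → Slide X Y → Evacuation Y → Move X Y
  slide⇒move {X} {Y} {y} X⊆U y∈Y (s , s-flow , s-bij) (z , z-flow , z-fix , z↦) with z-flow
  ... | identity    = contradiction y∈Y (x∈p─q⇒x∉q (z↦ y y∈Y))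
  ... | flow z-isFlow = record
    { fun       = z ∘ s
    ; isFlow    = flow¹-∘ʳ s-flow z-isFlow
    ; bijOn     = bijOn-∘ s-bij (bijOn-resp (λ x x∈ → sym (z-fix x (x∈p─q⇒x∉q x∈))) bijOn-id)
    ; evacuates = evacuates
    }
    where
    evacuates : MapsTo (z ∘ s) X (U ─ Y)
    evacuates x x∈X with s x ∈? Y
    ... | yes sx∈Y = z↦ (s x) sx∈Y
    ... | no  sx∉Y = subst (_∈ U ─ Y) (sym (z-fix (s x) sx∉Y))
                       (x∈p∧x∉q⇒x∈p─q (flow¹-mapsTo s-flow x (X⊆U x∈X)) sx∉Y)

  module _ {X Y : Subset n} (a-move : Move X Y) (b-move : Move Y X) where

    private
      W  = U ─ X
      W′ = U ─ Y
      open Move a-move using () renaming (fun to a; isFlow to a-flow; evacuates to a-evacuates)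
      open Move b-move using () renaming (fun to b; isFlow to b-flow)
      open BijOn (Move.bijOn a-move) using () renaming (mapsTo to a↦; onto to a-onto)
      open BijOn (Move.bijOn b-move) using ()
        renaming (mapsTo to b↦; injective to b-inj; onto to b-onto)

      b⁻¹ : Fin n → Fin n
      b⁻¹ = section b-onto

      b⁻¹↦ : MapsTo b⁻¹ W W′
      b⁻¹↦ = section-mapsTo b-onto

      b⁻¹∘b≈id : Agree W′ (b⁻¹ ∘ b) id
      b⁻¹∘b≈id x x∈W′ = b-inj _ _ (b⁻¹↦ _ (b↦ x x∈W′)) x∈W′ (section-inverse b-onto _ (b↦ x x∈W′))

      c-onto : Onto (b ∘ a) W W
      c-onto = onto-∘ a-onto b-onto

      c⁻¹ : Fin n → Fin n
      c⁻¹ = section c-onto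

      a∘c⁻¹∘b≈id : Agree W′ (a ∘ c⁻¹ ∘ b) id
      a∘c⁻¹∘b≈id x x∈W′ = b-inj _ _ (a↦ _ (section-mapsTo c-onto _ (b↦ x x∈W′))) x∈W′
                            (section-inverse c-onto _ (b↦ x x∈W′))

      c-admissible : Admissible W X (b ∘ a)
      c-admissible = mapsTo-∘ a↦ b↦ , c-onto , mapsTo-∘ a-evacuates b↦

      pullback-isPermOn : ∀ {π} → IsPermOn W π → IsPermOn W′ (b⁻¹ ∘ π ∘ b)
      pullback-isPermOn (π↦ , π-inj) =
        mapsTo-∘ π∘b↦ b⁻¹↦
        , injectiveOn-∘ π∘b↦ (injectiveOn-∘ b↦ b-inj π-inj) (section-injective b-onto)
        where π∘b↦ = mapsTo-∘ b↦ π↦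

      conjugated-admissible : ∀ {s} → Admissible W′ Y s → Admissible W X (b ∘ s ∘ a)
      conjugated-admissible (s↦ , s-onto , s-Y) =
        mapsTo-∘ (mapsTo-∘ a↦ s↦) b↦ , onto-∘ (onto-∘ a-onto s-onto) b-onto
        , mapsTo-∘ (mapsTo-∘ a-evacuates s↦) b↦

    conjugate : ∀ {g} → Defect H Y g →
                ∃[ g* ] (Defect H X g* × (∀ x → x ∈ W′ → g* (b x) ≡ b (g x)))
    -- b itself is not admissible at X, but b ∘ s ∘ a and b ∘ a are,
    -- and (b s a)(b a)⁻¹ acts as b s b⁻¹.
    conjugate (gen {s} s-flow s-adm) =
      b ∘ s ∘ a ∘ c⁻¹
      , comp (inv (gen (comp a-flow b-flow) c-admissible)
                  (section-mapsTo c-onto) (section-inverse c-onto))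
             (gen (comp (comp a-flow s-flow) b-flow) (conjugated-admissible s-adm))
      , λ x x∈W′ → cong (b ∘ s) (a∘c⁻¹∘b≈id x x∈W′)
    conjugate one = id , one , λ _ _ → refl
    conjugate (comp f g) with conjugate f | conjugate g
    ... | f* , f*-def , f*∘b≈b∘f | g* , g*-def , g*∘b≈b∘g =
      g* ∘ f* , comp f*-def g*-def
      , λ x x∈W′ → trans (cong g* (f*∘b≈b∘f x x∈W′)) (g*∘b≈b∘g _ (defect-mapsTo f x x∈W′))
    conjugate (inv {f} {g} f-def g↦ f∘g≈id) with conjugate f-def
    ... | f* , f*-def , f*∘b≈b∘f =
      b ∘ g ∘ b⁻¹ , inv f*-def (mapsTo-∘ (mapsTo-∘ b⁻¹↦ g↦) b↦) f*∘g*≈id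
      , λ x x∈W′ → cong (b ∘ g) (b⁻¹∘b≈id x x∈W′)
      where
      f*∘g*≈id : Agree W (f* ∘ b ∘ g ∘ b⁻¹) id
      f*∘g*≈id y y∈W = trans (f*∘b≈b∘f _ (g↦ _ (b⁻¹↦ y y∈W)))
                        (trans (cong b (f∘g≈id _ (b⁻¹↦ y y∈W))) (section-inverse b-onto y y∈W))

    move-transport : DefectFull H Y → DefectFull H X
    move-transport full π π-perm with full (b⁻¹ ∘ π ∘ b) (pullback-isPermOn π-perm)
    ... | g , g-def , g≈π′ with conjugate g-def
    ...   | g* , g*-def , g*∘b≈b∘g = g* , g*-def , agree
      where
      agree : Agree W g* π
      agree y y∈W = begin
        g* y                    ≡⟨ cong g* (sym (section-inverse b-onto y y∈W)) ⟩
        g* (b (b⁻¹ y))          ≡⟨ g*∘b≈b∘g _ (b⁻¹↦ y y∈W) ⟩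
        b (g (b⁻¹ y))           ≡⟨ cong b (g≈π′ _ (b⁻¹↦ y y∈W)) ⟩
        b (b⁻¹ (π (b (b⁻¹ y)))) ≡⟨ section-inverse b-onto _ (proj₁ π-perm _ (b↦ _ (b⁻¹↦ y y∈W))) ⟩
        π (b (b⁻¹ y))           ≡⟨ cong π (section-inverse b-onto y y∈W) ⟩
        π y                     ∎
        where open ≡-Reasoning

  module _ (H-conn : Connected H) where

    slide-step : ∀ {I X p q} → I ⊆ U → X ⊆ U → p ∈ X ─ I → q ∈ I ─ X →
                 ∃[ X′ ] (X ⇄ X′ × X′ ⊆ U × ∣ X′ ∣ ≡ ∣ X ∣ × ∣ X′ ─ I ∣ < ∣ X ─ I ∣)
    slide-step {I} {X} {p} {q} I⊆U X⊆U p∈X─I q∈I─X =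
      replace X p q
      , path-⇄ (H-conn q p (I⊆U q∈I) (X⊆U p∈X)) q∉X p∈X
      , X′⊆U
      , ∣replace∣ p∈X q∉X
      , ≤-<-trans (p⊆q⇒∣p∣≤∣q∣ X′─I⊆X─I-p) (x∈p⇒∣p-x∣<∣p∣ p∈X─I)
      where
      p∈X = x∈p─q⇒x∈p p∈X─I
      q∈I = x∈p─q⇒x∈p q∈I─X
      q∉X = x∈p─q⇒x∉q q∈I─X
      X′⊆U : replace X p q ⊆ U
      X′⊆U z∈ with ∈-replace⁻ z∈
      ... | inj₁ (z∈X , _) = X⊆U z∈X
      ... | inj₂ refl      = I⊆U q∈I
      X′─I⊆X─I-p : replace X p q ─ I ⊆ (X ─ I) - p
      X′─I⊆X─I-p z∈ with ∈-replace⁻ (x∈p─q⇒x∈p z∈)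
      ... | inj₁ (z∈X , z≢p) = x∈p∧x≢y⇒x∈p-y (x∈p∧x∉q⇒x∈p─q z∈X (x∈p─q⇒x∉q z∈)) z≢p
      ... | inj₂ refl        = contradiction q∈I (x∈p─q⇒x∉q z∈)

    slide-into : ∀ {I} → I ⊆ U → ∀ {X} → X ⊆ U → ∣ X ∣ ≤ ∣ I ∣ →
                 ∃[ Y ] (Y ⊆ I × ∣ Y ∣ ≡ ∣ X ∣ × X ⇄ Y)
    slide-into {I} I⊆U {X} = go (On.wellFounded (λ X → ∣ X ─ I ∣) <-wellFounded X)
      where
      go : ∀ {X} → Acc (_<_ on (λ X → ∣ X ─ I ∣)) X → X ⊆ U → ∣ X ∣ ≤ ∣ I ∣ →
           ∃[ Y ] (Y ⊆ I × ∣ Y ∣ ≡ ∣ X ∣ × X ⇄ Y)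
      go {X} (acc rec) X⊆U ∣X∣≤∣I∣ with nonempty? (X ─ I) | nonempty? (I ─ X)
      ... | no X─I≡∅ | _ = X , p─q≡∅⇒p⊆q X─I≡∅ , refl , ⇄-refl
      ... | yes (p , p∈X─I) | no I─X≡∅ = contradiction ∣X∣≤∣I∣ (<⇒≱ ∣I∣<∣X∣)
        where
        I⊆X-p : I ⊆ X - p
        I⊆X-p z∈I = x∈p∧x≢y⇒x∈p-y (p─q≡∅⇒p⊆q I─X≡∅ z∈I) λ { refl → x∈p─q⇒x∉q p∈X─I z∈I }
        ∣I∣<∣X∣ : ∣ I ∣ < ∣ X ∣
        ∣I∣<∣X∣ = ≤-<-trans (p⊆q⇒∣p∣≤∣q∣ I⊆X-p) (x∈p⇒∣p-x∣<∣p∣ (x∈p─q⇒x∈p p∈X─I))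
      ... | yes (p , p∈X─I) | yes (q , q∈I─X) with slide-step I⊆U X⊆U p∈X─I q∈I─X
      ...   | X′ , X⇄X′ , X′⊆U , ∣X′∣≡∣X∣ , smaller
              with go (rec smaller) X′⊆U (subst (_≤ ∣ I ∣) (sym ∣X′∣≡∣X∣) ∣X∣≤∣I∣)
      ...     | Y , Y⊆I , ∣Y∣≡∣X′∣ , X′⇄Y = Y , Y⊆I , trans ∣Y∣≡∣X′∣ ∣X′∣≡∣X∣ , ⇄-trans X⇄X′ X′⇄Y

    evacuate : ∀ {Y w} → Y ⊆ U → w ∈ U ─ Y → Evacuation Y
    evacuate {Y} {w} Y⊆U w∈U─Y =
      go (On.wellFounded ∣_∣ <-wellFounded Y) (λ x∈Y → x∈Y) identity (λ _ _ → refl)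
         (λ x x∈Y─Y → contradiction (x∈p─q⇒x∈p x∈Y─Y) (x∈p─q⇒x∉q x∈Y─Y))
      where
      go : ∀ {R z} → Acc (_<_ on ∣_∣) R → R ⊆ Y → Flow¹ E z → (∀ x → x ∉ Y → z x ≡ x) →
           MapsTo z (Y ─ R) (U ─ Y) → Evacuation Y
      go {R} {z} (acc rec) R⊆Y z-flow z-fix z↦ with nonempty? R
      ... | no R≡∅ = z , z-flow , z-fix , λ x x∈Y → z↦ x (x∈p∧x∉q⇒x∈p─q x∈Y (λ x∈R → R≡∅ (x , x∈R)))
      ... | yes (r , r∈R)
              with path-leaves (H-conn r w (Y⊆U (R⊆Y r∈R)) (x∈p─q⇒x∈p w∈U─Y)) r∈R
                               (λ w∈R → x∈p─q⇒x∉q w∈U─Y (R⊆Y w∈R))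
      ...   | p , y , e , p∈R , y∉R =
              go (rec (x∈p⇒∣p-x∣<∣p∣ p∈R)) (R⊆Y ∘ x∈p─q⇒x∈p) (flow¹-∘ (flow (gen e)) z-flow) fix′ ↦′
        where
        fix′ : ∀ x → x ∉ Y → z (collapse p y x) ≡ x
        fix′ x x∉Y = trans (cong z (collapse-other λ { refl → x∉Y (R⊆Y p∈R) })) (z-fix x x∉Y)
        ↦′ : MapsTo (z ∘ collapse p y) (Y ─ (R - p)) (U ─ Y)
        ↦′ x x∈ with x ≟ p
        ... | yes refl with y ∈? Y
        ...   | yes y∈Y = z↦ y (x∈p∧x∉q⇒x∈p─q y∈Y y∉R)
        ...   | no  y∉Y = subst (_∈ U ─ Y) (sym (z-fix y y∉Y)) (x∈p∧x∉q⇒x∈p─q (Es-tgt H e) y∉Y)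
        ↦′ x x∈ | no x≢p =
          z↦ x (x∈p∧x∉q⇒x∈p─q (x∈p─q⇒x∈p x∈) λ x∈R → x∈p─q⇒x∉q x∈ (x∈p∧x≢y⇒x∈p-y x∈R x≢p))

    fullAt-extend : ∀ {k I} → 0 < k → k < ∣ U ∣ → I ⊆ U → k ≤ ∣ I ∣ → FullAt H k I → FullAt H k U
    fullAt-extend {k} {I} 0<k k<∣U∣ I⊆U k≤∣I∣ full-I X X⊆U ∣X∣≡k
      with slide-into I⊆U X⊆U (subst (_≤ ∣ I ∣) (sym ∣X∣≡k) k≤∣I∣)
    ... | Y , Y⊆I , ∣Y∣≡∣X∣ , X→Y , Y→X =
      move-transport (toMove X⊆U Y⊆U ∣Y∣≡k X→Y) (toMove Y⊆U X⊆U ∣X∣≡k Y→X) (full-I Y Y⊆I ∣Y∣≡k)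
      where
      ∣Y∣≡k = trans ∣Y∣≡∣X∣ ∣X∣≡k
      Y⊆U : Y ⊆ U
      Y⊆U y∈Y = I⊆U (Y⊆I y∈Y)
      toMove : ∀ {A B} → A ⊆ U → B ⊆ U → ∣ B ∣ ≡ k → Slide A B → Move A B
      toMove A⊆U B⊆U ∣B∣≡k A→B
        with 0<∣p∣⇒p≢∅ (subst (0 <_) (sym ∣B∣≡k) 0<k)
           | ∣q∣<∣p∣⇒p─q≢∅ {p = U} (subst (_< ∣ U ∣) (sym ∣B∣≡k) k<∣U∣)
      ... | b , b∈B | w , w∈U─B = slide⇒move A⊆U b∈B A→B (evacuate B⊆U w∈U─B)

lemma5p5 : ∀ {n} (k : ℕ) → 2 ≤ k → (Γ : Graph n) → Connected (whole Γ)
    → (Γ₁ Γ₂ : Subgraph Γ) → IsKSubgraph k Γ₁ → IsKSubgraph k Γ₂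
    → k < ∣ Vs Γ₁ ∩ Vs Γ₂ ∣
    → IsKSubgraph k (Γ₁ ∪ᴳ Γ₂)
lemma5p5 k 2≤k Γ _ Γ₁ Γ₂ (conn₁ , _ , full₁) (conn₂ , _ , full₂) k<∣I∣ =
  conn , k<∣U∣
  , fullAt-extend conn 0<k k<∣U∣ I⊆U (<⇒≤ k<∣I∣) (∪ᴳ-fullAt {H₁ = Γ₁} {Γ₂} k<∣I∣ full₁ full₂)
  where
  open Sliding (Γ₁ ∪ᴳ Γ₂) using (fullAt-extend)
  I⊆U : Vs Γ₁ ∩ Vs Γ₂ ⊆ Vs (Γ₁ ∪ᴳ Γ₂)
  I⊆U x∈I = x∈p∪q⁺ (inj₁ (x∈p∩q⇒x∈p x∈I))
  k<∣U∣ : k < ∣ Vs (Γ₁ ∪ᴳ Γ₂) ∣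
  k<∣U∣ = <-≤-trans k<∣I∣ (p⊆q⇒∣p∣≤∣q∣ I⊆U)
  0<k : 0 < k
  0<k = ≤-trans (s≤s z≤n) 2≤k
  conn : Connected (Γ₁ ∪ᴳ Γ₂)
  conn with 0<∣p∣⇒p≢∅ (≤-<-trans z≤n k<∣I∣)
  ... | c , c∈I = ∪ᴳ-connected {H₁ = Γ₁} {Γ₂} conn₁ conn₂ (x∈p∩q⇒x∈p c∈I) (x∈p∩q⇒x∈q c∈I)
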